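{- Let $H$ be a finite simple graph with $\delta(H)\ge1$ and let $\{H=\mathcal H_1,\dots,\mathcal H_s\}$ be a $d$-sequence of $H$ such that $Z=\min\{z_i(H): 2\le i\le s\}$ is not positive. Let $T$ be a graph with a $d$-sequence $\{T=\mathcal T_1,\dots,\mathcal T_t\}$ satisfying $z_i(T)\ge0$ for all $2\le i\le t$. Let $G=H+T$. If $z_t(T)\ge d_H-Z$, then $|V(G)|+\delta(G)\le str(G)\le |V(G)|+d_T$.
   Context: For a graph $G$ of order $p$, a numbering is a bijection $f:V(G)\to\{1,\dots,p\}$; $str_f(G)=\max\{f(u)+f(v): uv\in E(G)\}$ and $str(G)=\min\{str_f(G)\}$ over numberings. $\delta(\cdot)$ is minimum degree, $+$ is disjoint union, $mK_1$ is $m$ isolated vertices, $K_r$ is the complete graph. Empty sums are $0$. $d$-sequence of a graph $X$ without isolated vertices: set $\mathcal X_1=X_1=X$, $m_1=0$. For $i\ge1$, if $\mathcal X_i$ is neither of the form $mK_1$ ($m\ge1$) nor $mK_1+K_r$ ($m\ge0$, $r\ge2$), write $\mathcal X_i=m_iK_1+X_i$ where $m_i\ge0$ is the number of isolated vertices of $\mathcal X_i$ and $X_i$ has no isolated vertices; choose any vertex $u_i$ of $X_i$, let $d_i$ be its degree in $X_i$, and obtain $\mathcal X_{i+1}$ from $\mathcal X_i$ by deleting its isolated vertices, $u_i$, and all neighbors of $u_i$. Stop at the first $s$ with $\mathcal X_s=m_sK_1$, $m_s\ge1$ (set $d_s=0$) or $\mathcal X_s=m_sK_1+K_r$, $m_s\ge0$,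 $r\ge2$ (set $d_s=r-1$). Write $d_X=d_1$ (the degree of the first chosen vertex), $y_j(X)=m_j+1-d_j$, and $z_i(X)=\sum_{j=2}^i y_j(X)$ for $2\le i\le s$. Here $d_H,z_i(H)$ refer to the given $d$-sequence of $H$ and $d_T,z_i(T)$ to the given $d$-sequence of $T$. -}

module Defs where

open import Data.Nat as ℕ using (ℕ; zero; suc; _⊔_; _⊓_; _∸_; _≡ᵇ_)
open import Data.Integer as ℤ using (ℤ; +_; 0ℤ)
open import Data.Bool using (Bool; true; false; _∧_; not; if_then_else_; T)
open import Data.Fin using (Fin; toℕ; splitAt; _≟_)
open import Data.Fin.Permutation using (Permutation′; _⟨$⟩ʳ_)
open import Data.Sum using (_⊎_; inj₁; inj₂)
open import Data.Product using (_×_; _,_; proj₁; proj₂)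
open import Data.List using (List; []; _∷_; map; foldr; concatMap; drop; allFin)
open import Data.Nat.ListAction using (sum)
open import Data.Maybe using (Maybe; just; nothing)
open import Relation.Nullary using (¬_; ⌊_⌋)
open import Relation.Binary.PropositionalEquality using (_≡_; _≢_; refl)

record Graph (n : ℕ) : Set where
  field
    adj    : Fin n → Fin n → Bool
    sym    : ∀ u v → adj u v ≡ adj v u
    irrefl : ∀ v → adj v v ≡ false
open Graph public

count : ∀ {n} → (Fin n → Bool) → ℕ
count {n} P = sum (map (λ v → if P v then 1 else 0) (allFin n))

deg : ∀ {n} → Graph n → Fin n → ℕ
deg G v = count (adj G v)

-- minimum of a list of naturals (0 for the empty list; only used for nonempty lists)
minList : List ℕ → ℕ
minList []           = 0
minList (x ∷ [])     = x
minList (x ∷ y ∷ xs) = x ⊓ minList (y ∷ xs)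

minDeg : ∀ {n} → Graph n → ℕ
minDeg {n} G = minList (map (deg G) (allFin n))

private
  uAdj : ∀ {p q} → Graph p → Graph q → Fin p ⊎ Fin q → Fin p ⊎ Fin q → Bool
  uAdj H K (inj₁ a) (inj₁ b) = adj H a b
  uAdj H K (inj₂ a) (inj₂ b) = adj K a b
  uAdj H K (inj₁ _) (inj₂ _) = false
  uAdj H K (inj₂ _) (inj₁ _) = false

  uSym : ∀ {p q} (H : Graph p) (K : Graph q) x y → uAdj H K x y ≡ uAdj H K y x
  uSym H K (inj₁ a) (inj₁ b) = sym H a b
  uSym H K (inj₂ a) (inj₂ b) = sym K a b
  uSym H K (inj₁ _) (inj₂ _) = refl
  uSym H K (inj₂ _) (inj₁ _) = refl

  uIrr : ∀ {p q} (H : Graph p) (K : Graph q) x → uAdj H K x x ≡ false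
  uIrr H K (inj₁ a) = irrefl H a
  uIrr H K (inj₂ a) = irrefl K a

_⊕_ : ∀ {p q} → Graph p → Graph q → Graph (p ℕ.+ q)
_⊕_ {p} H K = record
  { adj    = λ u v → uAdj H K (splitAt p u) (splitAt p v)
  ; sym    = λ u v → uSym H K (splitAt p u) (splitAt p v)
  ; irrefl = λ v → uIrr H K (splitAt p v) }

-- numbering: a bijection V → {1,…,n}, represented as a permutation π of Fin n
-- with f(v) = 1 + toℕ (π v).
label : ∀ {n} → Permutation′ n → Fin n → ℕ
label π v = suc (toℕ (π ⟨$⟩ʳ v))

-- str_f(G) = max { f(u)+f(v) : uv ∈ E(G) }   (0 if there are no edges)
strf : ∀ {n} → Graph n → Permutation′ n → ℕ
strf {n} G π =
  foldr _⊔_ 0 (concatMap (λ u → map (λ v → if adj G u v then label π u ℕ.+ label π v else 0)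
                                     (allFin n)) (allFin n))

-- d-sequences.  The current graph 𝓧_i is the subgraph of X induced by a
-- vertex subset S (a Boolean predicate).

Sub : ℕ → Set
Sub n = Fin n → Bool

full : ∀ {n} → Sub n
full _ = true

nbrs : ∀ {n} → Graph n → Sub n → Fin n → ℕ
nbrs G S v = count (λ w → S w ∧ adj G v w)

isolatedB : ∀ {n} → Graph n → Sub n → Fin n → Bool
isolatedB G S v = nbrs G S v ≡ᵇ 0

core : ∀ {n} → Graph n → Sub n → Fin n → Bool
core G S v = S v ∧ not (isolatedB G S v)

mIso : ∀ {n} → Graph n → Sub n → ℕ
mIso G S = count (λ v → S v ∧ isolatedB G S v)

rCore : ∀ {n} → Graph n → Sub n → ℕ
rCore G S = count (core G S)

-- 𝓧 = m K₁ with m ≥ 1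
IsEmptyForm : ∀ {n} → Graph n → Sub n → Set
IsEmptyForm G S = (1 ℕ.≤ mIso G S) × (rCore G S ≡ 0)

-- 𝓧 = m K₁ + K_r with m ≥ 0, r ≥ 2
IsCliqueForm : ∀ {n} → Graph n → Sub n → Set
IsCliqueForm G S =
  (2 ℕ.≤ rCore G S) ×
  (∀ u v → T (core G S u) → T (core G S v) → u ≢ v → T (adj G u v))

next : ∀ {n} → Graph n → Sub n → Fin n → Sub n
next G S u v = S v ∧ not (isolatedB G S v) ∧ not ⌊ v ≟ u ⌋ ∧ not (adj G u v)

data DSeq {n} (G : Graph n) : Sub n → Set where
  stopK1 : ∀ {S} → IsEmptyForm G S → DSeq G S
  stopKr : ∀ {S} → IsCliqueForm G S → DSeq G S
  step   : ∀ {S} → ¬ IsEmptyForm G S → ¬ IsCliqueForm G S →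
           (u : Fin n) → T (core G S u) → DSeq G (next G S u) → DSeq G S

mdList : ∀ {n} {G : Graph n} {S} → DSeq G S → List (ℕ × ℕ)
mdList {G = G} {S} (stopK1 _)        = (mIso G S , 0) ∷ []
mdList {G = G} {S} (stopKr _)        = (mIso G S , rCore G S ∸ 1) ∷ []
mdList {G = G} {S} (step _ _ u _ D)  = (mIso G S , nbrs G S u) ∷ mdList D

dFirst : ∀ {n} {G : Graph n} {S} → DSeq G S → ℕ
dFirst (stopK1 _)       = 0
dFirst {G = G} {S} (stopKr _) = rCore G S ∸ 1
dFirst {G = G} {S} (step _ _ u _ _) = nbrs G S u

yVal : ℕ × ℕ → ℤ
yVal (m , d) = (+ m ℤ.+ + 1) ℤ.- + d

-- y_2, …, y_s
yList : ∀ {n} {G : Graph n} {S} → DSeq G S → List ℤ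
yList D = map yVal (drop 1 (mdList D))

prefixSums : ℤ → List ℤ → List ℤ
prefixSums acc []       = []
prefixSums acc (y ∷ ys) = (acc ℤ.+ y) ∷ prefixSums (acc ℤ.+ y) ys

-- [ z_2 , …, z_s ]
zList : ∀ {n} {G : Graph n} {S} → DSeq G S → List ℤ
zList D = prefixSums 0ℤ (yList D)

-- z_s (empty sum 0 when s = 1)
zLast : ∀ {n} {G : Graph n} {S} → DSeq G S → ℤ
zLast D = foldr ℤ._+_ 0ℤ (yList D)

minℤ : List ℤ → Maybe ℤ
minℤ []       = nothing
minℤ (x ∷ xs) with minℤ xs
... | nothing = just x
... | just m  = just (x ℤ.⊓ m)

{-# OPTIONS --safe #-}
-- Lower bound: in any numbering f of G the vertex numbered |V(G)| has at least δ(G) neighbours,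
-- whose numbers are distinct and at most str_f(G) − |V(G)|.
--
-- Upper bound: a d-sequence of a graph X yields a numbering.  At stage i the neighbours of u_i
-- take the next d_i small numbers, u_i the largest number left for the non-isolated part of 𝓧_i,
-- and the isolated vertices of 𝓧_i the numbers right above it; the final clique is numbered
-- consecutively, except that its last vertex goes on top.  The largest edge sum at stage i is then
-- the number of u_i plus the largest number of a neighbour, and it is at most a bound B exactly
-- when σ + y_1 + ⋯ + y_i ≥ 1, where σ depends only on B and on where the numbering starts.
-- For G = H + T the small numbers of T come first, then all of H, then the large numbers of T.
-- With B = |V(G)| + d_T the condition for T reads z_i(T) ≥ 0, and the condition for H follows
-- from z_i(H) ≥ Z together with z_t(T) ≥ d_H − Z.

module Submission where

open import Defs hiding (sym)
open import Data.Bool using (Bool; true; false; _∧_; not; if_then_else_; T)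
open import Data.Bool.Properties using (∧-zeroʳ; ∧-identityʳ; ∧-assoc)
open import Data.Empty using (⊥-elim)
open import Data.Fin using (Fin; toℕ; fromℕ; fromℕ<; punchOut; splitAt; join; _≟_)
  renaming (zero to fzero; suc to fsuc)
import Data.Fin.Properties as Fin
open import Data.Fin.Permutation using (Permutation′; _⟨$⟩ʳ_; _⟨$⟩ˡ_; permutation; inverseˡ; inverseʳ)
open import Data.Integer as ℤ using (ℤ; +_; 0ℤ; 1ℤ; +≤+)
import Data.Integer.Properties as ℤP
import Data.Integer.Tactic.RingSolver as ℤ-Solver
open import Data.List using (List; []; _∷_; map; foldr; concatMap; allFin)
open import Data.List.Membership.Propositional using (_∈_)
open import Data.List.Membership.Propositional.Properties using (∈-map⁺; ∈-allFin)
open import Data.List.Properties using (map-tabulate; map-cong; foldr-preservesᵇ; foldr-forcesᵇ)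
open import Data.List.Relation.Unary.All as All using (All; []; _∷_)
import Data.List.Relation.Unary.All.Properties as Allₚ
open import Data.List.Relation.Unary.Any using (here; there)
open import Data.Maybe using (just; nothing)
open import Data.Nat as ℕ using (ℕ; zero; suc; _+_; _∸_; _≤_; _<_; z≤n; s≤s; z<s; _<ᵇ_)
open import Data.Nat.ListAction using (sum)
open import Data.Nat.Properties hiding (_≟_)
open import Algebra.Properties.CommutativeSemigroup +-commutativeSemigroup using (interchange)
open import Data.Nat.Tactic.RingSolver using (solve-∀)
open import Data.Product using (Σ; ∃; _×_; _,_; proj₁; proj₂)
open import Data.Sum using (_⊎_; inj₁; inj₂)
open import Data.Unit using (⊤; tt)
open import Function using (_∘_; id)
open import Function.Definitions using (Injective)
open import Relation.Binary.Definitions using (tri<; tri≈; tri>)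
open import Relation.Binary.PropositionalEquality
open import Relation.Nullary using (¬_; ⌊_⌋; yes; no)
open import Relation.Nullary.Decidable using (toWitness)

-- Booleans and counting

T-∧⁺ : ∀ {a b} → T a → T b → T (a ∧ b)
T-∧⁺ {true} _ tb = tb

T-∧⁻ˡ : ∀ a {b} → T (a ∧ b) → T a
T-∧⁻ˡ true _ = tt

T-∧⁻ʳ : ∀ a {b} → T (a ∧ b) → T b
T-∧⁻ʳ true tb = tb

T-not⁺ : ∀ {b} → ¬ T b → T (not b)
T-not⁺ {false} _ = tt
T-not⁺ {true} ¬t = ¬t tt

T-not⁻ : ∀ {b} → T (not b) → ¬ T b
T-not⁻ {false} _ ()

T-ext : ∀ {a b} → (T a → T b) → (T b → T a) → a ≡ b
T-ext {false} {false} _ _ = refl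
T-ext {false} {true} _ b⇒a = ⊥-elim (b⇒a tt)
T-ext {true} {false} a⇒b _ = ⊥-elim (a⇒b tt)
T-ext {true} {true} _ _ = refl

indicator : Bool → ℕ
indicator b = if b then 1 else 0

indicator-mono : ∀ {a b} → (T a → T b) → indicator a ≤ indicator b
indicator-mono {false} _ = z≤n
indicator-mono {true} {true} _ = ≤-refl
indicator-mono {true} {false} a⇒b = ⊥-elim (a⇒b tt)

indicator-true : ∀ {b} → T b → indicator b ≡ 1
indicator-true {true} _ = refl

indicator-split : ∀ a b → indicator a ≡ indicator (a ∧ b) + indicator (a ∧ not b)
indicator-split false _ = refl
indicator-split true false = refl
indicator-split true true = refl

count-suc : ∀ {n} (P : Fin (suc n) → Bool) → count P ≡ indicator (P fzero) + count (P ∘ fsuc)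
count-suc P = cong (λ xs → indicator (P fzero) + sum xs)
  (trans (map-tabulate fsuc (indicator ∘ P)) (sym (map-tabulate id (indicator ∘ P ∘ fsuc))))

count-cong : ∀ {n} {P Q : Fin n → Bool} → (∀ v → P v ≡ Q v) → count P ≡ count Q
count-cong {n} P≡Q = cong sum (map-cong (cong indicator ∘ P≡Q) (allFin n))

count-full : ∀ n → count {n} full ≡ n
count-full zero = refl
count-full (suc n) = trans (count-suc {n} full) (cong suc (count-full n))

count-none : ∀ n → count {n} (λ _ → false) ≡ 0
count-none zero = refl
count-none (suc n) = trans (count-suc {n} (λ _ → false)) (count-none n)

count-mono : ∀ {n} {P Q : Fin n → Bool} → (∀ v → T (P v) → T (Q v)) → count P ≤ count Q
count-mono {zero} _ = z≤n
count-mono {suc n} {P} {Q} P⇒Q rewrite count-suc P | count-suc Q =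
  +-mono-≤ (indicator-mono (P⇒Q fzero)) (count-mono (P⇒Q ∘ fsuc))

count-split : ∀ {n} (P Q : Fin n → Bool) →
  count P ≡ count (λ v → P v ∧ Q v) + count (λ v → P v ∧ not (Q v))
count-split {zero} P Q = refl
count-split {suc n} P Q
  rewrite count-suc P | count-suc (λ v → P v ∧ Q v) | count-suc (λ v → P v ∧ not (Q v))
        | indicator-split (P fzero) (Q fzero) | count-split (P ∘ fsuc) (Q ∘ fsuc) =
  interchange (indicator (P fzero ∧ Q fzero)) _ _ _

⌊suc≟suc⌋ : ∀ {n} (v u : Fin n) → ⌊ fsuc v ≟ fsuc u ⌋ ≡ ⌊ v ≟ u ⌋
⌊suc≟suc⌋ v u with v ≟ u
... | yes _ = refl
... | no _ = refl

count-at : ∀ {n} (P : Fin n → Bool) u → count (λ v → P v ∧ ⌊ v ≟ u ⌋) ≡ indicator (P u)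
count-at {suc n} P fzero rewrite count-suc (λ v → P v ∧ ⌊ v ≟ fzero ⌋) | ∧-identityʳ (P fzero) =
  trans (cong (λ c → indicator (P fzero) + c) (trans (count-cong (∧-zeroʳ ∘ P ∘ fsuc)) (count-none n)))
        (+-identityʳ _)
count-at {suc n} P (fsuc u) rewrite count-suc (λ v → P v ∧ ⌊ v ≟ fsuc u ⌋) | ∧-zeroʳ (P fzero) =
  trans (count-cong (λ v → cong (P (fsuc v) ∧_) (⌊suc≟suc⌋ v u))) (count-at (P ∘ fsuc) u)

count-remove : ∀ {n} (P : Fin n → Bool) u →
  count P ≡ indicator (P u) + count (λ v → P v ∧ not ⌊ v ≟ u ⌋)
count-remove P u = trans (count-split P (λ v → ⌊ v ≟ u ⌋))
  (cong (_+ count (λ v → P v ∧ not ⌊ v ≟ u ⌋)) (count-at P u))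

count-witness : ∀ {n} (P : Fin n → Bool) → 1 ≤ count P → ∃ λ v → T (P v)
count-witness {zero} P ()
count-witness {suc n} P 1≤count = witness (subst (1 ≤_) (count-suc P) 1≤count)
  where
    witness : 1 ≤ indicator (P fzero) + count (P ∘ fsuc) → ∃ λ v → T (P v)
    witness 1≤ with P fzero in P0
    ... | true = fzero , subst T (sym P0) tt
    ... | false = let v , Pv = count-witness (P ∘ fsuc) 1≤ in fsuc v , Pv

count-<-insert : ∀ {n} {P Q : Fin n → Bool} v → T (Q v) → ¬ T (P v) →
  (∀ w → T (P w) → T (Q w)) → count P < count Q
count-<-insert {P = P} {Q} v Qv ¬Pv P⇒Q rewrite count-remove Q v | indicator-true Qv =
  s≤s (count-mono λ w Pw → T-∧⁺ (P⇒Q w Pw) (T-not⁺ λ w≡v → ¬Pv (subst (T ∘ P) (toWitness w≡v) Pw)))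

count-positive : ∀ {n} (P : Fin n → Bool) v → T (P v) → 1 ≤ count P
count-positive P v Pv rewrite count-remove P v | indicator-true Pv = s≤s z≤n

count-∘-injective : ∀ {n m} (f : Fin n → Fin m) → Injective _≡_ _≡_ f →
  (Q : Fin m → Bool) → count (Q ∘ f) ≤ count Q
count-∘-injective {zero} f f-inj Q = z≤n
count-∘-injective {suc n} f f-inj Q rewrite count-suc (Q ∘ f) | count-remove Q (f fzero) =
  +-monoʳ-≤ (indicator (Q (f fzero)))
    (≤-trans (≤-reflexive (count-cong Q∘f∘suc≡))
             (count-∘-injective (f ∘ fsuc) (Fin.suc-injective ∘ f-inj) (λ v → Q v ∧ not ⌊ v ≟ f fzero ⌋)))
  where
    Q∘f∘suc≡ : ∀ i → Q (f (fsuc i)) ≡ Q (f (fsuc i)) ∧ not ⌊ f (fsuc i) ≟ f fzero ⌋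
    Q∘f∘suc≡ i with f (fsuc i) ≟ f fzero
    ... | yes eq = ⊥-elim (Fin.0≢1+n (sym (f-inj eq)))
    ... | no _ = sym (∧-identityʳ _)

count-below : ∀ {n} k → count {n} (λ i → toℕ i <ᵇ k) ≤ k
count-below {zero} k = z≤n
count-below {suc n} zero rewrite count-suc {n} (λ i → toℕ i <ᵇ zero) = count-below {n} zero
count-below {suc n} (suc k) rewrite count-suc {n} (λ i → toℕ i <ᵇ suc k) = s≤s (count-below {n} k)

rank : ∀ {n} → (Fin n → Bool) → Fin n → ℕ
rank P v = count (λ w → P w ∧ (toℕ w <ᵇ toℕ v))

rank<count : ∀ {n} (P : Fin n → Bool) v → T (P v) → rank P v < count P
rank<count P v Pv = count-<-insert v Pv (λ Pv∧v<v → n≮n (toℕ v) (<ᵇ⇒< _ _ (T-∧⁻ʳ (P v) Pv∧v<v)))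
  (λ w → T-∧⁻ˡ (P w))

rank-strictMono : ∀ {n} (P : Fin n → Bool) v w → T (P v) → toℕ v < toℕ w → rank P v < rank P w
rank-strictMono P v w Pv v<w = count-<-insert v (T-∧⁺ Pv (<⇒<ᵇ v<w))
  (λ Pv∧v<v → n≮n (toℕ v) (<ᵇ⇒< _ _ (T-∧⁻ʳ (P v) Pv∧v<v)))
  (λ x Px∧x<v → T-∧⁺ (T-∧⁻ˡ (P x) Px∧x<v) (<⇒<ᵇ (<-trans (<ᵇ⇒< _ _ (T-∧⁻ʳ (P x) Px∧x<v)) v<w)))

rank-injective : ∀ {n} (P : Fin n → Bool) v w → T (P v) → T (P w) → rank P v ≡ rank P w → v ≡ w
rank-injective P v w Pv Pw eq with <-cmp (toℕ v) (toℕ w)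
... | tri< v<w _ _ = ⊥-elim (<-irrefl eq (rank-strictMono P v w Pv v<w))
... | tri≈ _ v≡w _ = Fin.toℕ-injective v≡w
... | tri> _ _ w<v = ⊥-elim (<-irrefl (sym eq) (rank-strictMono P w v Pw w<v))

-- Numberings and str_f

module _ {N} (G : Graph N) (π : Permutation′ N) where

  private
    entry : Fin N → Fin N → ℕ
    entry u v = if adj G u v then label π u + label π v else 0

  strf-≤ : ∀ {B} → (∀ u v → T (adj G u v) → label π u + label π v ≤ B) → strf G π ≤ B
  strf-≤ {B} bound =
    foldr-preservesᵇ {P = _≤ B} ⊔-lub z≤n
      (Allₚ.concat⁺ (Allₚ.map⁺ (Allₚ.tabulate⁺ λ u → Allₚ.map⁺ (Allₚ.tabulate⁺ (entry≤ u)))))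
    where
      entry≤ : ∀ u v → entry u v ≤ B
      entry≤ u v with adj G u v in uv
      ... | true = bound u v (subst T (sym uv) tt)
      ... | false = z≤n

  edge≤strf : ∀ {u v} → T (adj G u v) → label π u + label π v ≤ strf G π
  edge≤strf {u} {v} uv = subst (_≤ strf G π) (entry≡ uv)
    (Allₚ.tabulate⁻ (Allₚ.map⁻ (Allₚ.tabulate⁻ (Allₚ.map⁻ (Allₚ.concat⁻ entries≤strf)) u)) v)
    where
      entries≤strf : All (_≤ strf G π) (concatMap (λ u → map (entry u) (allFin N)) (allFin N))
      entries≤strf = foldr-forcesᵇ {P = _≤ strf G π} {f = ℕ._⊔_}
        (λ x y x⊔y≤ → m⊔n≤o⇒m≤o x y x⊔y≤ , m⊔n≤o⇒n≤o x y x⊔y≤) 0 _ ≤-refl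
      entry≡ : T (adj G u v) → entry u v ≡ label π u + label π v
      entry≡ _ with adj G u v
      ... | true = refl

minList-≤ : ∀ {y} xs → y ∈ xs → minList xs ≤ y
minList-≤ (x ∷ []) (here refl) = ≤-refl
minList-≤ (x ∷ x′ ∷ xs) (here refl) = m⊓n≤m x _
minList-≤ (x ∷ x′ ∷ xs) (there y∈) = ≤-trans (m⊓n≤n x _) (minList-≤ (x′ ∷ xs) y∈)

minDeg≤deg : ∀ {N} (G : Graph N) v → minDeg G ≤ deg G v
minDeg≤deg {N} G v = minList-≤ (map (deg G) (allFin N)) (∈-map⁺ (deg G) (∈-allFin v))

injective⇒surjective : ∀ {n} (f : Fin n → Fin n) → Injective _≡_ _≡_ f → ∀ y → ∃ λ x → f x ≡ y
injective⇒surjective {suc n} f f-inj y with Fin.any? (λ x → f x ≟ y)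
... | yes hit = hit
... | no miss = ⊥-elim (<-irrefl refl (Fin.injective⇒≤ {f = skip-y} skip-y-injective))
  where
    y≢f : ∀ x → y ≢ f x
    y≢f x y≡fx = miss (x , sym y≡fx)
    skip-y : Fin (suc n) → Fin n
    skip-y x = punchOut (y≢f x)
    skip-y-injective : Injective _≡_ _≡_ skip-y
    skip-y-injective {x} {x′} eq = f-inj (Fin.punchOut-injective (y≢f x) (y≢f x′) eq)

injective⇒permutation : ∀ {n} (f : Fin n → Fin n) → Injective _≡_ _≡_ f →
  Σ (Permutation′ n) λ π → ∀ x → π ⟨$⟩ʳ x ≡ f x
injective⇒permutation f f-inj =
  permutation f (proj₁ ∘ surj) (proj₂ ∘ surj) (λ x → f-inj (proj₂ (surj (f x)))) , λ _ → refl
  where surj = injective⇒surjective f f-inj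

labelling⇒permutation : ∀ {N} (f : Fin N → ℕ) → (∀ x → 0 < f x × f x ≤ N) → Injective _≡_ _≡_ f →
  Σ (Permutation′ N) λ π → ∀ x → label π x ≡ f x
labelling⇒permutation {N} f range f-inj =
  let π , π≡ = injective⇒permutation φ φ-injective in π , λ x → trans (cong (suc ∘ toℕ) (π≡ x)) (suc-toℕ-φ x)
  where
    suc-pred-f : ∀ x → suc (ℕ.pred (f x)) ≡ f x
    suc-pred-f x = suc-pred (f x) {{ℕ.>-nonZero (proj₁ (range x))}}
    φ : Fin N → Fin N
    φ x = fromℕ< (subst (_≤ N) (sym (suc-pred-f x)) (proj₂ (range x)))
    suc-toℕ-φ : ∀ x → suc (toℕ (φ x)) ≡ f x
    suc-toℕ-φ x = trans (cong suc (Fin.toℕ-fromℕ< _)) (suc-pred-f x)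
    φ-injective : Injective _≡_ _≡_ φ
    φ-injective {x} {y} eq = f-inj (trans (sym (suc-toℕ-φ x)) (trans (cong (suc ∘ toℕ) eq) (suc-toℕ-φ y)))

strf-lower : ∀ {N} (G : Graph N) (π : Permutation′ N) → (∀ x → ∃ λ y → T (adj G x y)) →
  N + minDeg G ≤ strf G π
strf-lower {zero} G π _ = z≤n
strf-lower {suc n} G π has-neighbour = begin
  N + minDeg G       ≤⟨ +-monoʳ-≤ N (≤-trans (minDeg≤deg G top) deg-top≤) ⟩
  N + (s ∸ N)        ≡⟨ m+[n∸m]≡n N≤s ⟩
  s                  ∎
  where
    open ≤-Reasoning
    N s : ℕ
    N = suc n
    s = strf G π
    top : Fin N
    top = π ⟨$⟩ˡ fromℕ n
    label-top : label π top ≡ N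
    label-top = cong suc (trans (cong toℕ (inverseʳ π)) (Fin.toℕ-fromℕ n))
    N+label≤s : ∀ {w} → T (adj G top w) → N + label π w ≤ s
    N+label≤s {w} tw = subst (λ l → l + label π w ≤ s) label-top (edge≤strf G π tw)
    N≤s : N ≤ s
    N≤s = let _ , t = has-neighbour top in ≤-trans (m≤m+n N _) (N+label≤s t)
    π-injective : Injective _≡_ _≡_ (π ⟨$⟩ʳ_)
    π-injective eq = trans (sym (inverseˡ π)) (trans (cong (π ⟨$⟩ˡ_) eq) (inverseˡ π))
    neighbour-below : ∀ w → T (adj G top w) → T (toℕ (π ⟨$⟩ʳ w) <ᵇ (s ∸ N))
    neighbour-below w t = <⇒<ᵇ (m+n≤o⇒m≤o∸n (label π w) (subst (_≤ s) (+-comm N (label π w)) (N+label≤s t)))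
    deg-top≤ : deg G top ≤ s ∸ N
    deg-top≤ = begin
      deg G top                                            ≤⟨ count-mono neighbour-below ⟩
      count {N} ((λ i → toℕ i <ᵇ (s ∸ N)) ∘ (π ⟨$⟩ʳ_))    ≤⟨ count-∘-injective (π ⟨$⟩ʳ_) π-injective _ ⟩
      count {N} (λ i → toℕ i <ᵇ (s ∸ N))                   ≤⟨ count-below {N} (s ∸ N) ⟩
      s ∸ N                                                ∎

-- The numbering defined by a d-sequence

n∸1<n : ∀ {m n} → m < n → n ∸ 1 < n
n∸1<n {n = suc n} _ = ≤-refl

cliqueLow<cliqueTop : ∀ {k} r g → k < r ∸ 1 → suc k < r + g
cliqueLow<cliqueTop (suc r) g k<r-1 = s≤s (≤-trans k<r-1 (m≤m+n r g))

-- The clique vertex of rank k: the first r − 1 take the next small labels, the last one goes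
-- above the gap g.
cliqueOffset : ℕ → ℕ → ℕ → ℕ
cliqueOffset r g k = if k <ᵇ r ∸ 1 then suc k else r + g

cliqueOffset-cases : ∀ r g {k} → k < r →
  (k < r ∸ 1 × cliqueOffset r g k ≡ suc k) ⊎ (k ≡ r ∸ 1 × cliqueOffset r g k ≡ r + g)
cliqueOffset-cases r g {k} k<r with k <ᵇ r ∸ 1 in k<?
... | true = inj₁ (<ᵇ⇒< k (r ∸ 1) (subst T (sym k<?) tt) , refl)
... | false = inj₂ (≤-antisym (∸-monoˡ-≤ 1 k<r) (≮⇒≥ λ k<r-1 → subst T k<? (<⇒<ᵇ k<r-1)) , refl)

cliqueOffset-injective : ∀ r g {k k′} → k < r → k′ < r →
  cliqueOffset r g k ≡ cliqueOffset r g k′ → k ≡ k′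
cliqueOffset-injective r g k<r k′<r eq
  with cliqueOffset-cases r g k<r | cliqueOffset-cases r g k′<r
... | inj₁ (_ , e) | inj₁ (_ , e′) = suc-injective (trans (sym e) (trans eq e′))
... | inj₂ (k≡ , _) | inj₂ (k′≡ , _) = trans k≡ (sym k′≡)
... | inj₁ (k<r-1 , e) | inj₂ (_ , e′) =
  ⊥-elim (<⇒≢ (cliqueLow<cliqueTop r g k<r-1) (trans (sym e) (trans eq e′)))
... | inj₂ (_ , e) | inj₁ (k′<r-1 , e′) =
  ⊥-elim (<⇒≢ (cliqueLow<cliqueTop r g k′<r-1) (trans (sym e′) (trans (sym eq) e)))

cliqueOffset-pair : ∀ r g {k k′} → k < r → k′ < r → k ≢ k′ →
  cliqueOffset r g k + cliqueOffset r g k′ ≤ (r ∸ 1) + (r + g)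
cliqueOffset-pair r g k<r k′<r k≢k′
  with cliqueOffset-cases r g k<r | cliqueOffset-cases r g k′<r
... | inj₁ (k<r-1 , e) | inj₁ (_ , e′) rewrite e | e′ =
  +-mono-≤ k<r-1 (≤-trans k′<r (m≤m+n r g))
... | inj₁ (k<r-1 , e) | inj₂ (_ , e′) rewrite e | e′ = +-monoˡ-≤ (r + g) k<r-1
... | inj₂ (_ , e) | inj₁ (k′<r-1 , e′) rewrite e | e′ =
  ≤-trans (≤-reflexive (+-comm (r + g) _)) (+-monoˡ-≤ (r + g) k′<r-1)
... | inj₂ (k≡ , _) | inj₂ (k′≡ , _) = ⊥-elim (k≢k′ (trans k≡ (sym k′≡)))

prefixSums-shift : ∀ c x ys → prefixSums (c ℤ.+ x) ys ≡ map (λ z → c ℤ.+ z) (prefixSums x ys)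
prefixSums-shift c x [] = refl
prefixSums-shift c x (y ∷ ys) = cong₂ _∷_ (ℤP.+-assoc c x y)
  (trans (cong (λ s → prefixSums s ys) (ℤP.+-assoc c x y)) (prefixSums-shift c (x ℤ.+ y) ys))

slack⇒≤ : ∀ {x y} e → 1ℤ ℤ.≤ e → + y ≡ + x ℤ.+ e ℤ.- 1ℤ → x ≤ y
slack⇒≤ {x} {y} e 1≤e y≡ = ℤP.drop‿+≤+ (begin
  + x                    ≡⟨ ℤP.+-identityʳ (+ x) ⟨
  + x ℤ.+ 0ℤ             ≤⟨ ℤP.+-monoʳ-≤ (+ x) (ℤP.i≤j⇒0≤j-i 1≤e) ⟩
  + x ℤ.+ (e ℤ.- 1ℤ)     ≡⟨ ℤP.+-assoc (+ x) e (ℤ.- 1ℤ) ⟨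
  + x ℤ.+ e ℤ.- 1ℤ       ≡⟨ y≡ ⟨
  + y                    ∎)
  where open ℤP.≤-Reasoning

minℤ-nothing : ∀ {P : ℤ → Set} xs → minℤ xs ≡ nothing → All P xs
minℤ-nothing [] _ = []
minℤ-nothing (x ∷ xs) eq with minℤ xs
minℤ-nothing (x ∷ xs) () | nothing
minℤ-nothing (x ∷ xs) () | just _

minℤ-lowerBound : ∀ xs {Z} → minℤ xs ≡ just Z → All (Z ℤ.≤_) xs
minℤ-lowerBound (x ∷ xs) eq with minℤ xs in min-xs
minℤ-lowerBound (x ∷ xs) refl | nothing = ℤP.≤-refl ∷ minℤ-nothing xs min-xs
minℤ-lowerBound (x ∷ xs) refl | just m =
  ℤP.i⊓j≤i x m ∷ All.map (ℤP.≤-trans (ℤP.i⊓j≤j x m)) (minℤ-lowerBound xs min-xs)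

1≤1+ : ∀ {x} → 0ℤ ℤ.≤ x → 1ℤ ℤ.≤ 1ℤ ℤ.+ x
1≤1+ = ℤP.+-monoʳ-≤ 1ℤ

0≤+ : ∀ {x y} → 0ℤ ℤ.≤ x → 0ℤ ℤ.≤ y → 0ℤ ℤ.≤ x ℤ.+ y
0≤+ = ℤP.+-mono-≤

module _ {n} (X : Graph n) where

  adj-symᵀ : ∀ {v w} → T (adj X v w) → T (adj X w v)
  adj-symᵀ {v} {w} = subst T (Graph.sym X v w)

  adj-irreflᵀ : ∀ {v} → ¬ T (adj X v v)
  adj-irreflᵀ {v} = subst T (irrefl X v)

  isolated⇒¬adj : ∀ {S v w} → T (isolatedB X S v) → T (S w) → ¬ T (adj X v w)
  isolated⇒¬adj {S} {v} {w} iso Sw vw with ≡ᵇ⇒≡ (nbrs X S v) 0 iso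
  ... | nbrs≡0 = 1+n≰n (subst (1 ≤_) nbrs≡0 (count-positive (λ x → S x ∧ adj X v x) w (T-∧⁺ Sw vw)))

  count≡mIso+rCore : ∀ S → count S ≡ mIso X S + rCore X S
  count≡mIso+rCore S = count-split S (isolatedB X S)

  rCore-step : ∀ {S u} → T (core X S u) → rCore X S ≡ suc (nbrs X S u + count (next X S u))
  rCore-step {S} {u} core-u = begin
    rCore X S
      ≡⟨ count-remove (core X S) u ⟩
    indicator (core X S u) + count core∖u
      ≡⟨ cong₂ _+_ (indicator-true core-u) (count-split core∖u (adj X u)) ⟩
    suc (count (λ v → core∖u v ∧ adj X u v) + count (λ v → core∖u v ∧ not (adj X u v)))
      ≡⟨ cong suc (cong₂ _+_ (count-cong neighbours) (count-cong non-neighbours)) ⟩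
    suc (nbrs X S u + count (next X S u)) ∎
    where
      open ≡-Reasoning
      core∖u : Sub n
      core∖u v = core X S v ∧ not ⌊ v ≟ u ⌋
      Su : T (S u)
      Su = T-∧⁻ˡ (S u) core-u
      non-neighbours : ∀ v → core∖u v ∧ not (adj X u v) ≡ next X S u v
      non-neighbours v = trans (∧-assoc (core X S v) _ _) (∧-assoc (S v) _ _)
      neighbours : ∀ v → core∖u v ∧ adj X u v ≡ S v ∧ adj X u v
      neighbours v = T-ext
        (λ t → T-∧⁺ (T-∧⁻ˡ (S v) (T-∧⁻ˡ (core X S v) (T-∧⁻ˡ (core∖u v) t))) (T-∧⁻ʳ (core∖u v) t))
        (λ t → let Sv = T-∧⁻ˡ (S v) t ; uv = T-∧⁻ʳ (S v) t in
          T-∧⁺ (T-∧⁺ (T-∧⁺ Sv (T-not⁺ λ iso → isolated⇒¬adj iso Su (adj-symᵀ uv)))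
                     (T-not⁺ λ v≡u → adj-irreflᵀ (subst (T ∘ adj X u) (toWitness v≡u) uv)))
               uv)

  count-step : ∀ {S u} → T (core X S u) → count S ≡ mIso X S + suc (nbrs X S u + count (next X S u))
  count-step {S} core-u = trans (count≡mIso+rCore S) (cong (λ r → mIso X S + r) (rCore-step core-u))

  emptyForm⇒¬core : ∀ {S v} → IsEmptyForm X S → ¬ T (core X S v)
  emptyForm⇒¬core {S} {v} (_ , r≡0) core-v =
    1+n≰n (subst (1 ≤_) r≡0 (count-positive (core X S) v core-v))

  rCore≤count : ∀ S → rCore X S ≤ count S
  rCore≤count S = subst (rCore X S ≤_) (sym (count≡mIso+rCore S)) (m≤n+m _ _)

  next⇒¬adj : ∀ {S u w} → T (next X S u w) → ¬ T (adj X u w)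
  next⇒¬adj {S} {u} {w} next-w =
    T-not⁻ (T-∧⁻ʳ (not ⌊ w ≟ u ⌋) (T-∧⁻ʳ (not (isolatedB X S w)) (T-∧⁻ʳ (S w) next-w)))

  isolatedIn : Sub n → Sub n
  isolatedIn S v = S v ∧ isolatedB X S v

  neighbourIn : Sub n → Fin n → Sub n
  neighbourIn S u v = S v ∧ adj X u v

  isolatedIn⁺ : ∀ {S v} → T (S v) → isolatedB X S v ≡ true → T (isolatedIn S v)
  isolatedIn⁺ Sv iso = T-∧⁺ Sv (subst T (sym iso) tt)

  core⁺ : ∀ {S v} → T (S v) → isolatedB X S v ≡ false → T (core X S v)
  core⁺ Sv ¬iso = T-∧⁺ Sv (subst (T ∘ not) (sym ¬iso) tt)

  lowSize : ∀ {S} → DSeq X S → ℕ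
  lowSize (stopK1 _) = 0
  lowSize {S} (stopKr _) = rCore X S ∸ 1
  lowSize {S} (step _ _ u _ D) = nbrs X S u + lowSize D

  lowSize≤rCore : ∀ {S} (D : DSeq X S) → lowSize D ≤ rCore X S
  lowSize≤rCore (stopK1 _) = z≤n
  lowSize≤rCore {S} (stopKr _) = m∸n≤m (rCore X S) 1
  lowSize≤rCore {S} (step _ _ u core-u D) rewrite rCore-step core-u =
    m≤n⇒m≤1+n (+-monoʳ-≤ (nbrs X S u) (≤-trans (lowSize≤rCore D) (rCore≤count (next X S u))))

  isolatedLabel : Sub n → ℕ → ℕ → Fin n → ℕ
  isolatedLabel S a g v = a + rCore X S + g + suc (rank (isolatedIn S) v)

  -- dLabel D a g numbers 𝓧 = X[S] with the labels a+1, …, a+|S|+g, leaving out a gap of g labels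
  -- right above a + lowSize D, where the other graph of the union will sit.
  mutual
    dLabel : ∀ {S} → DSeq X S → ℕ → ℕ → Fin n → ℕ
    dLabel {S} D a g v = if isolatedB X S v then isolatedLabel S a g v else coreLabel D a g v

    coreLabel : ∀ {S} → DSeq X S → ℕ → ℕ → Fin n → ℕ
    coreLabel (stopK1 _) a g v = a  -- junk: 𝓧 has no core here
    coreLabel {S} (stopKr _) a g v = a + cliqueOffset (rCore X S) g (rank (core X S) v)
    coreLabel {S} (step _ _ u _ D) a g v =
      if ⌊ v ≟ u ⌋ then a + rCore X S + g
      else if adj X u v then a + suc (rank (neighbourIn S u) v)
      else dLabel D (a + nbrs X S u) g v

  data LabelCase {S} (D : DSeq X S) (a g : ℕ) (v : Fin n) : ℕ → Set where
    isolated : T (isolatedIn S v) → LabelCase D a g v (isolatedLabel S a g v)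
    inCore   : T (core X S v) → LabelCase D a g v (coreLabel D a g v)

  labelCase : ∀ {S} (D : DSeq X S) a g {v} → T (S v) → LabelCase D a g v (dLabel D a g v)
  labelCase {S} D a g {v} Sv with isolatedB X S v in iso
  ... | true = isolated (isolatedIn⁺ Sv iso)
  ... | false = inCore (core⁺ Sv iso)

  data StepCase {S} (u : Fin n) (D : DSeq X (next X S u)) (a g : ℕ) (v : Fin n) : ℕ → Set where
    pivot     : v ≡ u → StepCase u D a g v (a + rCore X S + g)
    neighbour : T (neighbourIn S u v) → StepCase u D a g v (a + suc (rank (neighbourIn S u) v))
    deeper    : T (next X S u v) → StepCase u D a g v (dLabel D (a + nbrs X S u) g v)

  stepCase : ∀ {S} ne nc u core-u (D : DSeq X (next X S u)) a g {v} → T (core X S v) →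
    StepCase {S} u D a g v (coreLabel (step ne nc u core-u D) a g v)
  stepCase {S} ne nc u core-u D a g {v} core-v with v ≟ u | adj X u v in uv
  ... | yes v≡u | _ = pivot v≡u
  ... | no _ | true = neighbour (T-∧⁺ (T-∧⁻ˡ (S v) core-v) (subst T (sym uv) tt))
  ... | no v≢u | false = deeper (T-∧⁺ (T-∧⁻ˡ (S v) core-v) (T-∧⁺ (T-∧⁻ʳ (S v) core-v)
                                 (T-∧⁺ (T-not⁺ (v≢u ∘ toWitness)) (subst (T ∘ not) (sym uv) tt))))

  isolatedLabel-range : ∀ {S v} a g → T (isolatedIn S v) →
    a + rCore X S + g < isolatedLabel S a g v × isolatedLabel S a g v ≤ a + count S + g
  isolatedLabel-range {S} {v} a g iso-v = m<m+n _ z<s , (begin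
    isolatedLabel S a g v             ≤⟨ +-monoʳ-≤ _ (rank<count (isolatedIn S) v iso-v) ⟩
    a + rCore X S + g + mIso X S      ≡⟨ shuffle a (rCore X S) g (mIso X S) ⟩
    a + (mIso X S + rCore X S) + g    ≡⟨ cong (λ s → a + s + g) (count≡mIso+rCore S) ⟨
    a + count S + g                   ∎)
    where
      open ≤-Reasoning
      shuffle : ∀ a r g m → a + r + g + m ≡ a + (m + r) + g
      shuffle = solve-∀

  module StepBounds {S u} (core-u : T (core X S u)) (a g : ℕ) where
    d r : ℕ
    d = nbrs X S u
    r = rCore X S

    deeperTop<pivot : a + d + count (next X S u) + g < a + r + g
    deeperTop<pivot rewrite rCore-step core-u = ≤-reflexive (shuffle a d (count (next X S u)) g)
      where
        shuffle : ∀ a d c g → suc (a + d + c + g) ≡ a + suc (d + c) + g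
        shuffle = solve-∀

    neighbourTop<pivot : a + d < a + r + g
    neighbourTop<pivot = ≤-<-trans (≤-trans (m≤m+n _ _) (m≤m+n _ _)) deeperTop<pivot

    neighbour-range : ∀ {v} → T (neighbourIn S u v) →
      a < a + suc (rank (neighbourIn S u) v) × a + suc (rank (neighbourIn S u) v) ≤ a + d
    neighbour-range {v} nb-v = m<m+n a z<s , +-monoʳ-≤ a (rank<count (neighbourIn S u) v nb-v)

    lowTop<pivot : (D : DSeq X (next X S u)) → a + (d + lowSize D) + g < a + r + g
    lowTop<pivot D = ≤-<-trans
      (≤-trans (≤-reflexive (cong (_+ g) (sym (+-assoc a d (lowSize D)))))
               (+-monoˡ-≤ g (+-monoʳ-≤ (a + d) (≤-trans (lowSize≤rCore D) (rCore≤count (next X S u))))))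
      deeperTop<pivot

  mutual
    dLabel-range : ∀ {S} (D : DSeq X S) a g {v} → T (S v) →
      a < dLabel D a g v × dLabel D a g v ≤ a + count S + g
    dLabel-range {S} D a g Sv = bounds (labelCase D a g Sv)
      where
        bounds : ∀ {v ℓ} → LabelCase D a g v ℓ → a < ℓ × ℓ ≤ a + count S + g
        bounds (isolated iso-v) = let above , below = isolatedLabel-range a g iso-v in
          ≤-<-trans (≤-trans (m≤m+n a _) (m≤m+n _ g)) above , below
        bounds (inCore core-v) = let above , below = coreLabel-range D a g core-v in
          above , ≤-trans below (+-monoˡ-≤ g (+-monoʳ-≤ a (rCore≤count S)))

    coreLabel-range : ∀ {S} (D : DSeq X S) a g {v} → T (core X S v) →
      a < coreLabel D a g v × coreLabel D a g v ≤ a + rCore X S + g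
    coreLabel-range (stopK1 empty) a g core-v = ⊥-elim (emptyForm⇒¬core empty core-v)
    coreLabel-range {S} (stopKr _) a g {v} core-v
      with k<r ← rank<count (core X S) v core-v | cliqueOffset-cases (rCore X S) g k<r
    ... | inj₁ (_ , offset≡) rewrite offset≡ =
      m<m+n a z<s , ≤-trans (+-monoʳ-≤ a k<r) (m≤m+n _ g)
    ... | inj₂ (_ , offset≡) rewrite offset≡ =
      m<m+n a (≤-trans (≤-trans z<s k<r) (m≤m+n _ g)) , ≤-reflexive (sym (+-assoc a _ g))
    coreLabel-range (step ne nc u core-u D) a g core-v =
      stepCase-range core-u (stepCase ne nc u core-u D a g core-v)

    stepCase-range : ∀ {S u D a g v ℓ} → T (core X S u) → StepCase {S} u D a g v ℓ →
      a < ℓ × ℓ ≤ a + rCore X S + g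
    stepCase-range {a = a} {g} core-u (pivot _) = ≤-<-trans (m≤m+n a _) neighbourTop<pivot , ≤-refl
      where open StepBounds core-u a g
    stepCase-range {a = a} {g} core-u (neighbour nb-v) =
      let above , below = neighbour-range nb-v in above , ≤-trans below (<⇒≤ neighbourTop<pivot)
      where open StepBounds core-u a g
    stepCase-range {D = D} {a} {g} core-u (deeper next-v) =
      let above , below = dLabel-range D (a + d) g next-v in
      ≤-<-trans (m≤m+n a d) above , ≤-trans below (<⇒≤ deeperTop<pivot)
      where open StepBounds core-u a g

  mutual
    dLabel-lowOrHigh : ∀ {S} (D : DSeq X S) a g {v} → T (S v) →
      dLabel D a g v ≤ a + lowSize D ⊎ a + lowSize D + g < dLabel D a g v
    dLabel-lowOrHigh D a g Sv = lowOrHigh (labelCase D a g Sv)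
      where
        lowOrHigh : ∀ {v ℓ} → LabelCase D a g v ℓ → ℓ ≤ a + lowSize D ⊎ a + lowSize D + g < ℓ
        lowOrHigh (isolated iso-v) = inj₂ (≤-<-trans (+-monoˡ-≤ g (+-monoʳ-≤ a (lowSize≤rCore D)))
                                                      (proj₁ (isolatedLabel-range a g iso-v)))
        lowOrHigh (inCore core-v) = coreLabel-lowOrHigh D a g core-v

    coreLabel-lowOrHigh : ∀ {S} (D : DSeq X S) a g {v} → T (core X S v) →
      coreLabel D a g v ≤ a + lowSize D ⊎ a + lowSize D + g < coreLabel D a g v
    coreLabel-lowOrHigh (stopK1 empty) a g core-v = ⊥-elim (emptyForm⇒¬core empty core-v)
    coreLabel-lowOrHigh {S} (stopKr _) a g {v} core-v
      with k<r ← rank<count (core X S) v core-v | cliqueOffset-cases (rCore X S) g k<r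
    ... | inj₁ (k<r-1 , offset≡) rewrite offset≡ = inj₁ (+-monoʳ-≤ a k<r-1)
    ... | inj₂ (_ , offset≡) rewrite offset≡ =
      inj₂ (<-≤-trans (+-monoˡ-< g (+-monoʳ-< a (n∸1<n k<r))) (≤-reflexive (+-assoc a _ g)))
    coreLabel-lowOrHigh (step ne nc u core-u D) a g core-v =
      stepCase-lowOrHigh core-u (stepCase ne nc u core-u D a g core-v)

    stepCase-lowOrHigh : ∀ {S u D a g v ℓ} → T (core X S u) → StepCase {S} u D a g v ℓ →
      ℓ ≤ a + (nbrs X S u + lowSize D) ⊎ a + (nbrs X S u + lowSize D) + g < ℓ
    stepCase-lowOrHigh {D = D} {a} {g} core-u (pivot _) = inj₂ (lowTop<pivot D)
      where open StepBounds core-u a g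
    stepCase-lowOrHigh {a = a} {g} core-u (neighbour nb-v) =
      inj₁ (≤-trans (proj₂ (neighbour-range nb-v)) (≤-trans (m≤m+n _ _) (≤-reflexive (+-assoc a d _))))
      where open StepBounds core-u a g
    stepCase-lowOrHigh {S} {u} {D} {a} {g} core-u (deeper next-v)
      rewrite sym (+-assoc a (nbrs X S u) (lowSize D)) = dLabel-lowOrHigh D (a + nbrs X S u) g next-v

  mutual
    dLabel-injective : ∀ {S} (D : DSeq X S) a g {v w} → T (S v) → T (S w) →
      dLabel D a g v ≡ dLabel D a g w → v ≡ w
    dLabel-injective {S} D a g Sv Sw = separate (labelCase D a g Sv) (labelCase D a g Sw)
      where
        core<isolated : ∀ {v w} → T (core X S v) → T (isolatedIn S w) → coreLabel D a g v < isolatedLabel S a g w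
        core<isolated core-v iso-w =
          ≤-<-trans (proj₂ (coreLabel-range D a g core-v)) (proj₁ (isolatedLabel-range a g iso-w))
        separate : ∀ {v w ℓ ℓ′} → LabelCase D a g v ℓ → LabelCase D a g w ℓ′ → ℓ ≡ ℓ′ → v ≡ w
        separate {v} {w} (isolated iso-v) (isolated iso-w) eq =
          rank-injective (isolatedIn S) v w iso-v iso-w (suc-injective (+-cancelˡ-≡ _ _ _ eq))
        separate (inCore core-v) (inCore core-w) eq = coreLabel-injective D a g core-v core-w eq
        separate (isolated iso-v) (inCore core-w) eq = ⊥-elim (<⇒≢ (core<isolated core-w iso-v) (sym eq))
        separate (inCore core-v) (isolated iso-w) eq = ⊥-elim (<⇒≢ (core<isolated core-v iso-w) eq)

    coreLabel-injective : ∀ {S} (D : DSeq X S) a g {v w} → T (core X S v) → T (core X S w) →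
      coreLabel D a g v ≡ coreLabel D a g w → v ≡ w
    coreLabel-injective (stopK1 empty) a g core-v _ _ = ⊥-elim (emptyForm⇒¬core empty core-v)
    coreLabel-injective {S} (stopKr _) a g {v} {w} core-v core-w eq =
      rank-injective (core X S) v w core-v core-w
        (cliqueOffset-injective (rCore X S) g (rank<count (core X S) v core-v) (rank<count (core X S) w core-w)
          (+-cancelˡ-≡ a _ _ eq))
    coreLabel-injective (step ne nc u core-u D) a g core-v core-w =
      stepCase-injective core-u (stepCase ne nc u core-u D a g core-v) (stepCase ne nc u core-u D a g core-w)

    -- The neighbours of the pivot, the deeper vertices and the pivot occupy consecutive label ranges.
    stepCase-injective : ∀ {S u D a g v w ℓ ℓ′} → T (core X S u) →
      StepCase {S} u D a g v ℓ → StepCase {S} u D a g w ℓ′ → ℓ ≡ ℓ′ → v ≡ w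
    stepCase-injective _ (pivot v≡u) (pivot w≡u) _ = trans v≡u (sym w≡u)
    stepCase-injective {S} {u} {a = a} {v = v} {w} _ (neighbour nb-v) (neighbour nb-w) eq =
      rank-injective (neighbourIn S u) v w nb-v nb-w (suc-injective (+-cancelˡ-≡ a _ _ eq))
    stepCase-injective {S} {u} {D} {a} {g} _ (deeper next-v) (deeper next-w) eq =
      dLabel-injective D (a + nbrs X S u) g next-v next-w eq
    stepCase-injective {a = a} {g} core-u (neighbour nb-v) (pivot _) eq =
      ⊥-elim (<⇒≢ (≤-<-trans (proj₂ (neighbour-range nb-v)) neighbourTop<pivot) eq)
      where open StepBounds core-u a g
    stepCase-injective {a = a} {g} core-u (pivot _) (neighbour nb-w) eq =
      ⊥-elim (<⇒≢ (≤-<-trans (proj₂ (neighbour-range nb-w)) neighbourTop<pivot) (sym eq))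
      where open StepBounds core-u a g
    stepCase-injective {D = D} {a} {g} core-u (deeper next-v) (pivot _) eq =
      ⊥-elim (<⇒≢ (≤-<-trans (proj₂ (dLabel-range D (a + d) g next-v)) deeperTop<pivot) eq)
      where open StepBounds core-u a g
    stepCase-injective {D = D} {a} {g} core-u (pivot _) (deeper next-w) eq =
      ⊥-elim (<⇒≢ (≤-<-trans (proj₂ (dLabel-range D (a + d) g next-w)) deeperTop<pivot) (sym eq))
      where open StepBounds core-u a g
    stepCase-injective {D = D} {a} {g} core-u (neighbour nb-v) (deeper next-w) eq =
      ⊥-elim (<⇒≢ (≤-<-trans (proj₂ (neighbour-range nb-v)) (proj₁ (dLabel-range D (a + d) g next-w))) eq)
      where open StepBounds core-u a g
    stepCase-injective {D = D} {a} {g} core-u (deeper next-v) (neighbour nb-w) eq =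
      ⊥-elim (<⇒≢ (≤-<-trans (proj₂ (neighbour-range nb-w)) (proj₁ (dLabel-range D (a + d) g next-v))) (sym eq))
      where open StepBounds core-u a g

  -- At every stage the largest label sum over an edge is pivot + largest neighbour label;
  -- on the final clique it is the sum of its two largest labels.
  WithinBudget : ∀ {S} → DSeq X S → ℕ → ℕ → ℕ → Set
  WithinBudget (stopK1 _) a g B = ⊤
  WithinBudget {S} (stopKr _) a g B = a + (rCore X S ∸ 1) + (a + rCore X S + g) ≤ B
  WithinBudget {S} (step _ _ u _ D) a g B =
    a + nbrs X S u + (a + rCore X S + g) ≤ B × WithinBudget D (a + nbrs X S u) g B

  mutual
    dLabel-edge : ∀ {S} (D : DSeq X S) a g B → WithinBudget D a g B → ∀ {v w} → T (S v) → T (S w) →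
      T (adj X v w) → dLabel D a g v + dLabel D a g w ≤ B
    dLabel-edge {S} D a g B budget {v} {w} Sv Sw vw = edge (labelCase D a g Sv) (labelCase D a g Sw)
      where
        edge : ∀ {ℓ ℓ′} → LabelCase D a g v ℓ → LabelCase D a g w ℓ′ → ℓ + ℓ′ ≤ B
        edge (isolated iso-v) _ = ⊥-elim (isolated⇒¬adj (T-∧⁻ʳ (S v) iso-v) Sw vw)
        edge (inCore _) (isolated iso-w) = ⊥-elim (isolated⇒¬adj (T-∧⁻ʳ (S w) iso-w) Sv (adj-symᵀ vw))
        edge (inCore core-v) (inCore core-w) = coreLabel-edge D a g B budget core-v core-w vw

    coreLabel-edge : ∀ {S} (D : DSeq X S) a g B → WithinBudget D a g B → ∀ {v w} →
      T (core X S v) → T (core X S w) → T (adj X v w) → coreLabel D a g v + coreLabel D a g w ≤ B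
    coreLabel-edge (stopK1 empty) a g B _ core-v _ _ = ⊥-elim (emptyForm⇒¬core empty core-v)
    coreLabel-edge {S} (stopKr _) a g B budget {v} {w} core-v core-w vw = begin
      a + cliqueOffset r g k + (a + cliqueOffset r g k′)  ≡⟨ interchange a _ a _ ⟩
      a + a + (cliqueOffset r g k + cliqueOffset r g k′)  ≤⟨ +-monoʳ-≤ (a + a) (cliqueOffset-pair r g k<r k′<r k≢k′) ⟩
      a + a + ((r ∸ 1) + (r + g))                          ≡⟨ interchange a a (r ∸ 1) (r + g) ⟩
      a + (r ∸ 1) + (a + (r + g))                          ≡⟨ cong (λ x → a + (r ∸ 1) + x) (+-assoc a r g) ⟨
      a + (r ∸ 1) + (a + r + g)                            ≤⟨ budget ⟩
      B                                                    ∎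
      where
        open ≤-Reasoning
        r = rCore X S
        k = rank (core X S) v
        k′ = rank (core X S) w
        k<r = rank<count (core X S) v core-v
        k′<r = rank<count (core X S) w core-w
        k≢k′ : k ≢ k′
        k≢k′ k≡k′ =
          adj-irreflᵀ (subst (T ∘ adj X v) (sym (rank-injective (core X S) v w core-v core-w k≡k′)) vw)
    coreLabel-edge (step ne nc u core-u D) a g B (pivotSum≤B , budget) core-v core-w =
      stepCase-edge core-u pivotSum≤B budget (stepCase ne nc u core-u D a g core-v) (stepCase ne nc u core-u D a g core-w)

    stepCase-edge : ∀ {S u D a g B v w ℓ ℓ′} → T (core X S u) →
      a + nbrs X S u + (a + rCore X S + g) ≤ B → WithinBudget D (a + nbrs X S u) g B →
      StepCase {S} u D a g v ℓ → StepCase {S} u D a g w ℓ′ → T (adj X v w) → ℓ + ℓ′ ≤ B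
    stepCase-edge _ _ _ (pivot refl) (pivot refl) vw = ⊥-elim (adj-irreflᵀ vw)
    stepCase-edge {S} _ _ _ (pivot refl) (deeper next-w) vw = ⊥-elim (next⇒¬adj {S} next-w vw)
    stepCase-edge {S} _ _ _ (deeper next-v) (pivot refl) vw = ⊥-elim (next⇒¬adj {S} next-v (adj-symᵀ vw))
    stepCase-edge {S} {u} {D} {a} {g} {B} _ _ budget (deeper next-v) (deeper next-w) vw =
      dLabel-edge D (a + nbrs X S u) g B budget next-v next-w vw
    stepCase-edge {a = a} {g} core-u pivotSum≤B _ (neighbour nb-v) (pivot _) _ =
      ≤-trans (+-monoˡ-≤ _ (proj₂ (neighbour-range nb-v))) pivotSum≤B
      where open StepBounds core-u a g
    stepCase-edge {a = a} {g} {ℓ = ℓ} {ℓ′} core-u pivotSum≤B _ (pivot _) (neighbour nb-w) _ =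
      ≤-trans (≤-reflexive (+-comm ℓ ℓ′)) (≤-trans (+-monoˡ-≤ ℓ (proj₂ (neighbour-range nb-w))) pivotSum≤B)
      where open StepBounds core-u a g
    stepCase-edge {a = a} {g} core-u pivotSum≤B _ (neighbour nb-v) (neighbour nb-w) _ =
      ≤-trans (+-mono-≤ (proj₂ (neighbour-range nb-v))
                        (≤-trans (proj₂ (neighbour-range nb-w)) (<⇒≤ neighbourTop<pivot))) pivotSum≤B
      where open StepBounds core-u a g
    stepCase-edge {D = D} {a} {g} core-u pivotSum≤B _ (neighbour nb-v) (deeper next-w) _ =
      ≤-trans (+-mono-≤ (proj₂ (neighbour-range nb-v))
                        (≤-trans (proj₂ (dLabel-range D (a + d) g next-w)) (<⇒≤ deeperTop<pivot))) pivotSum≤B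
      where open StepBounds core-u a g
    stepCase-edge {D = D} {a} {g} {ℓ = ℓ} {ℓ′} core-u pivotSum≤B _ (deeper next-v) (neighbour nb-w) _ =
      ≤-trans (≤-reflexive (+-comm ℓ ℓ′))
        (≤-trans (+-mono-≤ (proj₂ (neighbour-range nb-w))
                           (≤-trans (proj₂ (dLabel-range D (a + d) g next-v)) (<⇒≤ deeperTop<pivot))) pivotSum≤B)
      where open StepBounds core-u a g

  yValues : ∀ {S} → DSeq X S → List ℤ
  yValues D = map yVal (mdList D)

  ySum : ∀ {S} → DSeq X S → ℤ
  ySum D = foldr ℤ._+_ 0ℤ (yValues D)

  ySum≡y₁+zLast : ∀ {S} (D : DSeq X S) → ySum D ≡ yVal (mIso X S , dFirst D) ℤ.+ zLast D
  ySum≡y₁+zLast (stopK1 _) = refl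
  ySum≡y₁+zLast (stopKr _) = refl
  ySum≡y₁+zLast (step _ _ _ _ _) = refl

  stage-withinBudget : ∀ {S} a g B σ d → σ ℤ.+ + (a + a + count S + g) ≡ + B →
    1ℤ ℤ.≤ σ ℤ.+ yVal (mIso X S , d) → a + d + (a + rCore X S + g) ≤ B
  stage-withinBudget {S} a g B σ d B≡ 1≤σ+y = slack⇒≤ _ 1≤σ+y (begin
    + B                                                       ≡⟨ B≡ ⟨
    σ ℤ.+ + (a + a + count S + g)                              ≡⟨ cong (λ c → σ ℤ.+ + (a + a + c + g))
                                                                       (count≡mIso+rCore S) ⟩
    σ ℤ.+ + (a + a + (m + r) + g)                              ≡⟨ shuffle σ (+ a) (+ d) (+ r) (+ m) (+ g) ⟩
    + (a + d + (a + r + g)) ℤ.+ (σ ℤ.+ yVal (m , d)) ℤ.- 1ℤ   ∎)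
    where
      open ≡-Reasoning
      m = mIso X S
      r = rCore X S
      shuffle : ∀ σ a d r m g → σ ℤ.+ (a ℤ.+ a ℤ.+ (m ℤ.+ r) ℤ.+ g)
                              ≡ a ℤ.+ d ℤ.+ (a ℤ.+ r ℤ.+ g) ℤ.+ (σ ℤ.+ ((m ℤ.+ 1ℤ) ℤ.- d)) ℤ.- 1ℤ
      shuffle = ℤ-Solver.solve-∀

  -- σ stands for B − 2a − |S| − g, so the condition at stage i is exactly 1 ≤ σ + y_i.
  withinBudget-fromPrefixSums : ∀ {S} (D : DSeq X S) a g B σ →
    σ ℤ.+ + (a + a + count S + g) ≡ + B → All (1ℤ ℤ.≤_) (prefixSums σ (yValues D)) →
    WithinBudget D a g B
  withinBudget-fromPrefixSums (stopK1 _) a g B σ _ _ = tt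
  withinBudget-fromPrefixSums {S} (stopKr _) a g B σ B≡ (1≤σ+y ∷ []) =
    stage-withinBudget a g B σ (rCore X S ∸ 1) B≡ 1≤σ+y
  withinBudget-fromPrefixSums {S} (step _ _ u core-u D) a g B σ B≡ (1≤σ+y ∷ 1≤rest) =
    stage-withinBudget a g B σ d B≡ 1≤σ+y ,
    withinBudget-fromPrefixSums D (a + d) g B (σ ℤ.+ y) invariant 1≤rest
    where
      open ≡-Reasoning
      d = nbrs X S u
      m = mIso X S
      c = count (next X S u)
      y = yVal (m , d)
      invariant : σ ℤ.+ y ℤ.+ + (a + d + (a + d) + c + g) ≡ + B
      invariant = begin
        σ ℤ.+ y ℤ.+ + (a + d + (a + d) + c + g)      ≡⟨ shuffle σ (+ a) (+ d) (+ c) (+ m) (+ g) ⟩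
        σ ℤ.+ + (a + a + (m + suc (d + c)) + g)     ≡⟨ cong (λ s → σ ℤ.+ + (a + a + s + g))
                                                               (count-step core-u) ⟨
        σ ℤ.+ + (a + a + count S + g)               ≡⟨ B≡ ⟩
        + B                                         ∎
        where
          shuffle : ∀ σ a d c m g →
            σ ℤ.+ ((m ℤ.+ 1ℤ) ℤ.- d) ℤ.+ (a ℤ.+ d ℤ.+ (a ℤ.+ d) ℤ.+ c ℤ.+ g)
              ≡ σ ℤ.+ (a ℤ.+ a ℤ.+ (m ℤ.+ (1ℤ ℤ.+ (d ℤ.+ c))) ℤ.+ g)
          shuffle = ℤ-Solver.solve-∀

  stop-lowSize-bound : ∀ {S} l → l ≤ rCore X S →
    + (l + l) ℤ.+ (yVal (mIso X S , l) ℤ.+ 0ℤ) ℤ.≤ + count S ℤ.+ 1ℤ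
  stop-lowSize-bound {S} l l≤r = begin
    + (l + l) ℤ.+ (yVal (m , l) ℤ.+ 0ℤ)   ≡⟨ shuffle (+ l) (+ m) ⟩
    + (m + l) ℤ.+ 1ℤ                       ≤⟨ ℤP.+-monoˡ-≤ 1ℤ (+≤+ (+-monoʳ-≤ m l≤r)) ⟩
    + (m + rCore X S) ℤ.+ 1ℤ               ≡⟨ cong (λ s → + s ℤ.+ 1ℤ) (count≡mIso+rCore S) ⟨
    + count S ℤ.+ 1ℤ                       ∎
    where
      open ℤP.≤-Reasoning
      m = mIso X S
      shuffle : ∀ l m → l ℤ.+ l ℤ.+ ((m ℤ.+ 1ℤ) ℤ.- l ℤ.+ 0ℤ) ≡ m ℤ.+ l ℤ.+ 1ℤ
      shuffle = ℤ-Solver.solve-∀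

  lowSize-bound : ∀ {S} (D : DSeq X S) → + (lowSize D + lowSize D) ℤ.+ ySum D ℤ.≤ + count S ℤ.+ 1ℤ
  lowSize-bound (stopK1 _) = stop-lowSize-bound 0 z≤n
  lowSize-bound {S} (stopKr _) = stop-lowSize-bound (rCore X S ∸ 1) (m∸n≤m (rCore X S) 1)
  lowSize-bound {S} (step _ _ u core-u D) = begin
    + (d + l + (d + l)) ℤ.+ (y ℤ.+ ySum D)          ≡⟨ shuffle (+ d) (+ l) y (ySum D) ⟩
    + (l + l) ℤ.+ ySum D ℤ.+ (+ (d + d) ℤ.+ y)      ≤⟨ ℤP.+-monoˡ-≤ (+ (d + d) ℤ.+ y) (lowSize-bound D) ⟩
    + c ℤ.+ 1ℤ ℤ.+ (+ (d + d) ℤ.+ y)                ≡⟨ shuffle′ (+ c) (+ d) (+ m) ⟩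
    + (m + suc (d + c)) ℤ.+ 1ℤ                       ≡⟨ cong (λ s → + s ℤ.+ 1ℤ) (count-step core-u) ⟨
    + count S ℤ.+ 1ℤ                                 ∎
    where
      open ℤP.≤-Reasoning
      d = nbrs X S u
      l = lowSize D
      m = mIso X S
      c = count (next X S u)
      y = yVal (m , d)
      shuffle : ∀ d l y s → d ℤ.+ l ℤ.+ (d ℤ.+ l) ℤ.+ (y ℤ.+ s) ≡ l ℤ.+ l ℤ.+ s ℤ.+ (d ℤ.+ d ℤ.+ y)
      shuffle = ℤ-Solver.solve-∀
      shuffle′ : ∀ c d m →
        c ℤ.+ 1ℤ ℤ.+ (d ℤ.+ d ℤ.+ ((m ℤ.+ 1ℤ) ℤ.- d)) ≡ m ℤ.+ (1ℤ ℤ.+ (d ℤ.+ c)) ℤ.+ 1ℤ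
      shuffle′ = ℤ-Solver.solve-∀

  prefixSums-from-zList : ∀ {S} (D : DSeq X S) σ →
    let σ₁ = σ ℤ.+ yVal (mIso X S , dFirst D) in
    1ℤ ℤ.≤ σ₁ → All (λ z → 1ℤ ℤ.≤ σ₁ ℤ.+ z) (zList D) →
    All (1ℤ ℤ.≤_) (prefixSums σ (yValues D))
  prefixSums-from-zList (stopK1 _) σ 1≤σ₁ _ = 1≤σ₁ ∷ []
  prefixSums-from-zList (stopKr _) σ 1≤σ₁ _ = 1≤σ₁ ∷ []
  prefixSums-from-zList {S} (step _ _ u _ D) σ 1≤σ₁ 1≤σ₁+z =
    1≤σ₁ ∷ subst (All (1ℤ ℤ.≤_)) (sym shifted) (Allₚ.map⁺ 1≤σ₁+z)
    where
      σ₁ = σ ℤ.+ yVal (mIso X S , nbrs X S u)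
      shifted : prefixSums σ₁ (yValues D) ≡ map (λ z → σ₁ ℤ.+ z) (prefixSums 0ℤ (yValues D))
      shifted = trans (cong (λ s → prefixSums s (yValues D)) (sym (ℤP.+-identityʳ σ₁)))
                      (prefixSums-shift σ₁ 0ℤ (yValues D))

-- The disjoint union H + T

module _ {p q} (H : Graph p) (K : Graph q) where

  sideAdj : Fin p ⊎ Fin q → Fin p ⊎ Fin q → Bool
  sideAdj (inj₁ a) (inj₁ b) = adj H a b
  sideAdj (inj₂ a) (inj₂ b) = adj K a b
  sideAdj (inj₁ _) (inj₂ _) = false
  sideAdj (inj₂ _) (inj₁ _) = false

  adj-⊕ : ∀ x y → adj (H ⊕ K) x y ≡ sideAdj (splitAt p x) (splitAt p y)
  adj-⊕ x y with splitAt p x | splitAt p y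
  ... | inj₁ _ | inj₁ _ = refl
  ... | inj₁ _ | inj₂ _ = refl
  ... | inj₂ _ | inj₁ _ = refl
  ... | inj₂ _ | inj₂ _ = refl

  ⊕-has-neighbour : (∀ v → 1 ≤ deg H v) → (∀ v → 1 ≤ deg K v) → ∀ x → ∃ λ y → T (adj (H ⊕ K) x y)
  ⊕-has-neighbour δH≥1 δK≥1 x =
    let t , st = side-neighbour (splitAt p x) in
    join p q t , subst T (sym (trans (adj-⊕ x (join p q t)) (cong (sideAdj (splitAt p x)) (Fin.splitAt-join p q t)))) st
    where
      side-neighbour : ∀ s → ∃ λ t → T (sideAdj s t)
      side-neighbour (inj₁ h) = let w , hw = count-witness (adj H h) (δH≥1 h) in inj₁ w , hw
      side-neighbour (inj₂ k) = let w , kw = count-witness (adj K k) (δK≥1 k) in inj₂ w , kw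

module _ {p q} {H : Graph p} {K : Graph q} (DH : DSeq H full) (DK : DSeq K full) where

  private
    A B : ℕ
    A = lowSize K DK
    B = p + q + dFirst DK

  -- The small labels 1, …, A of K come first, H fills the gap A+1, …, A+p of K′s numbering.
  unionLabel : Fin p ⊎ Fin q → ℕ
  unionLabel (inj₁ h) = dLabel H DH A 0 h
  unionLabel (inj₂ k) = dLabel K DK 0 p k

  private
    A≤q : A ≤ q
    A≤q = ≤-trans (lowSize≤rCore K DK) (subst (rCore K full ≤_) (count-full q) (rCore≤count K full))

    H-range : ∀ h → A < unionLabel (inj₁ h) × unionLabel (inj₁ h) ≤ A + p
    H-range h = let above , below = dLabel-range H DH A 0 {h} tt in
      above , subst (unionLabel (inj₁ h) ≤_) (trans (+-identityʳ _) (cong (λ c → A + c) (count-full p))) below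

  unionLabel-range : ∀ s → 0 < unionLabel s × unionLabel s ≤ p + q
  unionLabel-range (inj₁ h) = let above , below = H-range h in
    ≤-trans (s≤s z≤n) above , ≤-trans below (≤-trans (+-monoˡ-≤ p A≤q) (≤-reflexive (+-comm q p)))
  unionLabel-range (inj₂ k) = let above , below = dLabel-range K DK 0 p {k} tt in
    above , subst (unionLabel (inj₂ k) ≤_) (trans (cong (_+ p) (count-full q)) (+-comm q p)) below

  unionLabel-sides-disjoint : ∀ h k → unionLabel (inj₁ h) ≢ unionLabel (inj₂ k)
  unionLabel-sides-disjoint h k eq with dLabel-lowOrHigh K DK 0 p {k} tt
  ... | inj₁ low = <⇒≢ (≤-<-trans low (proj₁ (H-range h))) (sym eq)
  ... | inj₂ high = <⇒≢ (≤-<-trans (proj₂ (H-range h)) high) eq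

  unionLabel-injective : Injective _≡_ _≡_ unionLabel
  unionLabel-injective {inj₁ a} {inj₁ b} eq = cong inj₁ (dLabel-injective H DH A 0 tt tt eq)
  unionLabel-injective {inj₂ a} {inj₂ b} eq = cong inj₂ (dLabel-injective K DK 0 p tt tt eq)
  unionLabel-injective {inj₁ a} {inj₂ b} eq = ⊥-elim (unionLabel-sides-disjoint a b eq)
  unionLabel-injective {inj₂ a} {inj₁ b} eq = ⊥-elim (unionLabel-sides-disjoint b a (sym eq))

  unionLabel-edge : WithinBudget H DH A 0 B → WithinBudget K DK 0 p B →
    ∀ s t → T (sideAdj H K s t) → unionLabel s + unionLabel t ≤ B
  unionLabel-edge budgetH _ (inj₁ a) (inj₁ b) ab = dLabel-edge H DH A 0 B budgetH tt tt ab
  unionLabel-edge _ budgetK (inj₂ a) (inj₂ b) ab = dLabel-edge K DK 0 p B budgetK tt tt ab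

  union-numbering : WithinBudget H DH A 0 B → WithinBudget K DK 0 p B →
    ∃ λ (π : Permutation′ (p + q)) → strf (H ⊕ K) π ≤ B
  union-numbering budgetH budgetK =
    let π , label≡ = labelling⇒permutation (unionLabel ∘ splitAt p) (unionLabel-range ∘ splitAt p)
                                            splitAt-injective in
    π , strf-≤ (H ⊕ K) π λ u v uv →
      subst₂ (λ ℓ ℓ′ → ℓ + ℓ′ ≤ B) (sym (label≡ u)) (sym (label≡ v))
        (unionLabel-edge budgetH budgetK (splitAt p u) (splitAt p v) (subst T (adj-⊕ H K u v) uv))
    where
      splitAt-injective : Injective _≡_ _≡_ (unionLabel ∘ splitAt p)
      splitAt-injective {x} {y} eq =
        trans (sym (Fin.join-splitAt p q x))
              (trans (cong (join p q) (unionLabel-injective {splitAt p x} {splitAt p y} eq)) (Fin.join-splitAt p q y))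

  K-withinBudget : All (0ℤ ℤ.≤_) (zList DK) → WithinBudget K DK 0 p B
  K-withinBudget zK≥0 = withinBudget-fromPrefixSums K DK 0 p B (+ dK) invariant
    (prefixSums-from-zList K DK (+ dK) (subst (1ℤ ℤ.≤_) (sym σ₁≡) (1≤1+ (+≤+ z≤n)))
      (All.map (λ {z} z≥0 → subst (1ℤ ℤ.≤_) (trans (sym (ℤP.+-assoc 1ℤ (+ m) z)) (cong (ℤ._+ z) (sym σ₁≡)))
                                   (1≤1+ (0≤+ (+≤+ z≤n) z≥0))) zK≥0))
    where
      dK = dFirst DK
      m = mIso K full
      invariant : + dK ℤ.+ + (0 + 0 + count {q} full + p) ≡ + B
      invariant = trans (cong (λ c → + (dK + (c + p))) (count-full q)) (cong +_ (shuffle dK q p))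
        where
          shuffle : ∀ d q p → d + (q + p) ≡ p + q + d
          shuffle = solve-∀
      σ₁≡ : + dK ℤ.+ yVal (m , dK) ≡ 1ℤ ℤ.+ + m
      σ₁≡ = shuffle (+ dK) (+ m)
        where
          shuffle : ∀ d m → d ℤ.+ ((m ℤ.+ 1ℤ) ℤ.- d) ≡ 1ℤ ℤ.+ m
          shuffle = ℤ-Solver.solve-∀

  private
    σH : ℤ
    σH = + B ℤ.- + (A + A + count {p} full + 0)

    σH₁ : ℤ
    σH₁ = σH ℤ.+ yVal (mIso H full , dFirst DH)

    -- lowSize-bound for K turns the hypothesis z_t(T) ≥ d_H − Z into the slack needed for H.
    1≤σH₁+Z : ∀ Z → (+ dFirst DH) ℤ.- Z ℤ.≤ zLast DK → 1ℤ ℤ.≤ σH₁ ℤ.+ Z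
    1≤σH₁+Z Z dH-Z≤zK =
      subst (1ℤ ℤ.≤_) (sym σH₁+Z≡) (1≤1+ (0≤+ slackK (0≤+ (+≤+ z≤n) (0≤+ (+≤+ z≤n) slackZ))))
      where
        dH = dFirst DH
        dK = dFirst DK
        mH = mIso H full
        mK = mIso K full
        zK = zLast DK
        slackK : 0ℤ ℤ.≤ (+ q ℤ.+ 1ℤ) ℤ.- (+ (A + A) ℤ.+ (yVal (mK , dK) ℤ.+ zK))
        slackK = ℤP.i≤j⇒0≤j-i (subst₂ (λ y c → + (A + A) ℤ.+ y ℤ.≤ + c ℤ.+ 1ℤ)
                                      (ySum≡y₁+zLast K DK) (count-full q) (lowSize-bound K DK))
        slackZ : 0ℤ ℤ.≤ zK ℤ.- ((+ dH) ℤ.- Z)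
        slackZ = ℤP.i≤j⇒0≤j-i dH-Z≤zK
        σH₁+Z≡ : σH₁ ℤ.+ Z ≡ 1ℤ ℤ.+ ((+ q ℤ.+ 1ℤ) ℤ.- (+ (A + A) ℤ.+ (yVal (mK , dK) ℤ.+ zK))
                                      ℤ.+ (+ mK ℤ.+ (+ mH ℤ.+ (zK ℤ.- ((+ dH) ℤ.- Z)))))
        σH₁+Z≡ rewrite count-full p = shuffle (+ p) (+ q) (+ dK) (+ A) (+ mH) (+ dH) (+ mK) zK Z
          where
            shuffle : ∀ p q dK A mH dH mK zK Z →
              (p ℤ.+ q ℤ.+ dK) ℤ.- (A ℤ.+ A ℤ.+ p ℤ.+ 0ℤ) ℤ.+ ((mH ℤ.+ 1ℤ) ℤ.- dH) ℤ.+ Z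
                ≡ 1ℤ ℤ.+ ((q ℤ.+ 1ℤ) ℤ.- (A ℤ.+ A ℤ.+ ((mK ℤ.+ 1ℤ) ℤ.- dK ℤ.+ zK))
                          ℤ.+ (mK ℤ.+ (mH ℤ.+ (zK ℤ.- (dH ℤ.- Z)))))
            shuffle = ℤ-Solver.solve-∀

  H-withinBudget : ∀ Z → minℤ (zList DH) ≡ just Z → Z ℤ.≤ 0ℤ → (+ dFirst DH) ℤ.- Z ℤ.≤ zLast DK →
    WithinBudget H DH A 0 B
  H-withinBudget Z min≡Z Z≤0 dH-Z≤zK = withinBudget-fromPrefixSums H DH A 0 B σH invariant
    (prefixSums-from-zList H DH σH
      (ℤP.≤-trans 1≤σ₁+Z (ℤP.≤-trans (ℤP.+-monoʳ-≤ σH₁ Z≤0) (ℤP.≤-reflexive (ℤP.+-identityʳ σH₁))))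
      (All.map (λ Z≤z → ℤP.≤-trans 1≤σ₁+Z (ℤP.+-monoʳ-≤ σH₁ Z≤z)) (minℤ-lowerBound _ min≡Z)))
    where
      1≤σ₁+Z = 1≤σH₁+Z Z dH-Z≤zK
      invariant : σH ℤ.+ + (A + A + count {p} full + 0) ≡ + B
      invariant = cancel (+ B) (+ (A + A + count {p} full + 0))
        where
          cancel : ∀ x y → x ℤ.- y ℤ.+ y ≡ x
          cancel = ℤ-Solver.solve-∀

mainTheorem7 : ∀ {p q} (H : Graph p) (K : Graph q)
    → (∀ v → 1 ≤ deg H v)
    → (DH : DSeq H full)
    → (Z : ℤ) → minℤ (zList DH) ≡ just Z → Z ℤ.≤ 0ℤ
    → (∀ v → 1 ≤ deg K v)
    → (DK : DSeq K full)
    → All (0ℤ ℤ.≤_) (zList DK)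
    → (+ dFirst DH) ℤ.- Z ℤ.≤ zLast DK
    → (∀ (π : Permutation′ (p + q)) → (p + q) + minDeg (H ⊕ K) ≤ strf (H ⊕ K) π)
      × ∃ (λ (π : Permutation′ (p + q)) → strf (H ⊕ K) π ≤ (p + q) + dFirst DK)
mainTheorem7 H K δH≥1 DH Z min≡Z Z≤0 δK≥1 DK zK≥0 dH-Z≤zK =
  (λ π → strf-lower (H ⊕ K) π (⊕-has-neighbour H K δH≥1 δK≥1)) ,
  union-numbering DH DK (H-withinBudget DH DK Z min≡Z Z≤0 dH-Z≤zK) (K-withinBudget DH DK zK≥0)
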